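{- Let $G=(V,E)$ be a connected graph on $m$ vertices with maximum degree at most $k$. Then for every natural number $l$ there exist pairwise disjoint vertex sets $V_1,\dots,V_t\subseteq V$ such that: (1) $lk\le |V_i|\le lk^2$ for every $1\le i\le t$; (2) $\sum_{i=1}^t|V_i|\ge m-lk$; (3) the induced subgraph $G[V_i]$ is connected for every $1\le i\le t$. -}

module Defs where

open import Data.Nat using (ℕ)
open import Data.Bool using (Bool; true; false)
open import Data.Fin using (Fin)
open import Data.Fin.Subset using (Subset; _∈_; ∣_∣; ⊤)
open import Data.Vec using (tabulate)
open import Relation.Binary.PropositionalEquality using (_≡_)

record Graph (m : ℕ) : Set where
  field
    Adj    : Fin m → Fin m → Bool
    sym    : ∀ u v → Adj u v ≡ Adj v u
    irrefl : ∀ u → Adj u u ≡ false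

open Graph public

neighbourhood : ∀ {m} → Graph m → Fin m → Subset m
neighbourhood G v = tabulate (λ w → Adj G v w)

degree : ∀ {m} → Graph m → Fin m → ℕ
degree G v = ∣ neighbourhood G v ∣

data WalkIn {m : ℕ} (G : Graph m) (S : Subset m) : Fin m → Fin m → Set where
  here : ∀ {u} → u ∈ S → WalkIn G S u u
  step : ∀ {u v w} → u ∈ S → Adj G u v ≡ true → WalkIn G S v w → WalkIn G S u w

InducedConnected : ∀ {m} → Graph m → Subset m → Set
InducedConnected G S = ∀ u v → u ∈ S → v ∈ S → WalkIn G S u v

-- G is connected (nonempty vertex set is required separately)
Connected : ∀ {m} → Graph m → Set
Connected G = InducedConnected G ⊤

{-# OPTIONS --safe #-}
-- Take a spanning tree T of G rooted anywhere and listing every vertex exactly once; a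
-- vertex's children are distinct neighbours, so every node has at most k children. Prune T
-- bottom up with L = lk: once the subtree of a child has been pruned, what is left of it
-- hangs from that child by at most k branches of fewer than L vertices each, so it has at
-- most 1 + k(L - 1) ≤ Lk = lk² vertices; it is cut off as a part if it has at least L
-- vertices and stays attached otherwise. The parts are connected and disjoint, and only the
-- remainder at the root, of fewer than L vertices, is left uncovered.
module Submission where

open import Defs
open import Algebra.Bundles using (CommutativeMonoid)
open import Data.Bool using (true)
open import Data.Empty using (⊥)
open import Data.Fin using (Fin; zero; suc; _≟_)
open import Data.Fin.Properties using (¬∀⟶∃¬)
open import Data.Fin.Subset using (Subset; inside; outside; _∈_; _∉_; ∣_∣; ⁅_⁆; _∪_; ⋃) renaming (⊤ to ⊤ˢ)
open import Data.Fin.Subset.Properties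
  using (∉⊥; ∈⊤; x∈⁅x⁆; x∈⁅y⁆⇒x≡y; ∣⁅x⁆∣≡1; ∣⊥∣≡0; ∣⊤∣≡n; x∈p∪q⁺; x∈p∪q⁻; p⊆q⇒∣p∣≤∣q∣)
open import Data.List using (List; []; _∷_; _++_; length; lookup; concatMap; map)
open import Data.List.Properties using (length-++; ++-assoc; ++-identityʳ; concatMap-++)
open import Data.List.Membership.Propositional using () renaming (_∈_ to _∈ˡ_; _∉_ to _∉ˡ_)
open import Data.List.Membership.Propositional.Properties using (∈-++⁺ˡ; ∈-++⁺ʳ; ∈-++⁻; ∈-lookup)
open import Data.List.Relation.Binary.Disjoint.Propositional using (Disjoint)
open import Data.List.Relation.Binary.Permutation.Propositional
  using (_↭_; ↭-refl; ↭-sym; ↭-trans; ↭-reflexive; ↭⇒↭ₛ; module PermutationReasoning)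
open import Data.List.Relation.Binary.Permutation.Propositional.Properties
  using (++⁺; ++⁺ʳ; ++⁺ˡ; shift; shifts; ++-comm; ↭-length; ++-commutativeMonoid)
import Data.List.Relation.Binary.Permutation.Setoid.Properties as Permutationₛ
open import Data.List.Relation.Unary.All as All using (All; []; _∷_)
open import Data.List.Relation.Unary.All.Properties using (¬Any⇒All¬; ++⁻ˡ) renaming (++⁺ to All-++⁺)
open import Data.List.Relation.Unary.Any using (here; there)
open import Data.List.Relation.Unary.Unique.Propositional using (Unique; []; _∷_)
open import Data.List.Relation.Unary.Unique.Propositional.Properties using (Unique[x∷xs]⇒x∉xs)
open import Data.Nat using (ℕ; zero; suc; _+_; _*_; _∸_; _^_; _≤_; _<_; z≤n; s≤s; s≤s⁻¹; _≤?_)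
open import Data.Nat.Properties
  using ( ≤-refl; ≤-trans; ≤-reflexive; <⇒≤; <⇒≱; ≰⇒>; <-trans; n<1+n; m≤n⇒m≤1+n; m+n≤o⇒m≤o
        ; m≤n+o⇒m∸n≤o; +-suc; +-assoc; +-comm; +-identityʳ; +-mono-≤; +-monoʳ-≤; *-mono-≤
        ; *-monoˡ-≤; *-comm; *-assoc; ^-identityʳ; module ≤-Reasoning)
open import Data.Product using (Σ; ∃; ∃₂; -,_; _×_; _,_; proj₂)
open import Data.Sum using (inj₁; inj₂)
open import Data.Unit using (⊤; tt)
open import Data.Vec as Vec using (tabulate; sum; []; _∷_)
open import Data.Vec.Properties using (lookup⇒[]=; lookup∘tabulate)
open import Function using (_∘_)
open import Relation.Binary.PropositionalEquality as ≡ using (_≡_; _≢_; refl; cong; cong₂; subst)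
open import Relation.Nullary using (yes; no; contradiction)

module _ {A : Set} where

  open import Algebra.Properties.CommutativeSemigroup
    (CommutativeMonoid.commutativeSemigroup (++-commutativeMonoid {A = A})) using (interchange)

  Unique-resp-↭ : ∀ {xs ys : List A} → xs ↭ ys → Unique xs → Unique ys
  Unique-resp-↭ xs↭ys = Permutationₛ.Unique-resp-↭ (≡.setoid A) (↭⇒↭ₛ xs↭ys)

  Unique-++⁻ˡ : ∀ (xs : List A) {ys} → Unique (xs ++ ys) → Unique xs
  Unique-++⁻ˡ []       _        = []
  Unique-++⁻ˡ (x ∷ xs) (x∉ ∷ u) = ++⁻ˡ xs x∉ ∷ Unique-++⁻ˡ xs u

  Unique-++⁻ʳ : ∀ (xs : List A) {ys} → Unique (xs ++ ys) → Unique ys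
  Unique-++⁻ʳ []       u       = u
  Unique-++⁻ʳ (x ∷ xs) (_ ∷ u) = Unique-++⁻ʳ xs u

  Unique-++⇒Disjoint : ∀ (xs : List A) {ys} → Unique (xs ++ ys) → Disjoint xs ys
  Unique-++⇒Disjoint (x ∷ xs) (x∉ ∷ _) (here refl  , v∈ys) = All.lookup x∉ (∈-++⁺ʳ xs v∈ys) refl
  Unique-++⇒Disjoint (x ∷ xs) (_ ∷ u)  (there v∈xs , v∈ys) = Unique-++⇒Disjoint xs u (v∈xs , v∈ys)

  ++-interchange : (a b c d : List A) → (a ++ b) ++ (c ++ d) ↭ (a ++ c) ++ (b ++ d)
  ++-interchange = interchange

  ++-shifts : (a b c : List A) → (a ++ b) ++ c ↭ b ++ (a ++ c)
  ++-shifts a b c = ↭-trans (↭-reflexive (++-assoc a b c)) (shifts a b)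

module _ {A B : Set} (f : A → List B) where

  ∈-concatMap-lookup : ∀ xs i {v} → v ∈ˡ f (lookup xs i) → v ∈ˡ concatMap f xs
  ∈-concatMap-lookup (x ∷ xs) zero    v∈ = ∈-++⁺ˡ v∈
  ∈-concatMap-lookup (x ∷ xs) (suc i) v∈ = ∈-++⁺ʳ (f x) (∈-concatMap-lookup xs i v∈)

  Unique-concatMap⇒Unique-lookup : ∀ xs i → Unique (concatMap f xs) → Unique (f (lookup xs i))
  Unique-concatMap⇒Unique-lookup (x ∷ xs) zero    u = Unique-++⁻ˡ (f x) u
  Unique-concatMap⇒Unique-lookup (x ∷ xs) (suc i) u =
    Unique-concatMap⇒Unique-lookup xs i (Unique-++⁻ʳ (f x) u)

  Unique-concatMap⇒Disjoint-lookup : ∀ xs {i j} → i ≢ j → Unique (concatMap f xs) →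
                                     Disjoint (f (lookup xs i)) (f (lookup xs j))
  Unique-concatMap⇒Disjoint-lookup (x ∷ xs) {zero}  {zero}  i≢j _ = contradiction refl i≢j
  Unique-concatMap⇒Disjoint-lookup (x ∷ xs) {zero}  {suc j} _   u (v∈x , v∈j) =
    Unique-++⇒Disjoint (f x) u (v∈x , ∈-concatMap-lookup xs j v∈j)
  Unique-concatMap⇒Disjoint-lookup (x ∷ xs) {suc i} {zero}  _   u (v∈i , v∈x) =
    Unique-++⇒Disjoint (f x) u (v∈x , ∈-concatMap-lookup xs i v∈i)
  Unique-concatMap⇒Disjoint-lookup (x ∷ xs) {suc i} {suc j} i≢j u =
    Unique-concatMap⇒Disjoint-lookup xs (i≢j ∘ cong suc) (Unique-++⁻ʳ (f x) u)

s+c≤1+c*L⇒s≤L*k : ∀ {s c L k} → 1 ≤ L → 1 ≤ k → c ≤ k → s + c ≤ suc (c * L) → s ≤ L * k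
s+c≤1+c*L⇒s≤L*k {s} {zero}          L≥1 k≥1 _   s≤1 =
  ≤-trans (subst (_≤ 1) (+-identityʳ s) s≤1) (*-mono-≤ L≥1 k≥1)
s+c≤1+c*L⇒s≤L*k {s} {suc c} {L} {k} _   _   c<k le = begin
  s          ≤⟨ m+n≤o⇒m≤o s (s≤s⁻¹ (subst (_≤ suc (suc c * L)) (+-suc s c) le)) ⟩
  suc c * L  ≤⟨ *-monoˡ-≤ L c<k ⟩
  k * L      ≡⟨ *-comm k L ⟩
  L * k      ∎
  where open ≤-Reasoning

∣p∪q∣≡∣p∣+∣q∣ : ∀ {n} (p q : Subset n) → (∀ {x} → x ∈ p → x ∉ q) → ∣ p ∪ q ∣ ≡ ∣ p ∣ + ∣ q ∣
∣p∪q∣≡∣p∣+∣q∣ []      []      _   = refl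
∣p∪q∣≡∣p∣+∣q∣ (s ∷ p) (t ∷ q) p#q
  with ∣p∪q∣≡∣p∣+∣q∣ p q (λ x∈p x∈q → p#q (Vec.there x∈p) (Vec.there x∈q))
∣p∪q∣≡∣p∣+∣q∣ (inside  ∷ p) (inside  ∷ q) p#q | _  = contradiction Vec.here (p#q Vec.here)
∣p∪q∣≡∣p∣+∣q∣ (inside  ∷ p) (outside ∷ q) _   | eq = cong suc eq
∣p∪q∣≡∣p∣+∣q∣ (outside ∷ p) (inside  ∷ q) _   | eq = ≡.trans (cong suc eq) (≡.sym (+-suc ∣ p ∣ ∣ q ∣))
∣p∪q∣≡∣p∣+∣q∣ (outside ∷ p) (outside ∷ q) _   | eq = eq

fromList : ∀ {n} → List (Fin n) → Subset n
fromList xs = ⋃ (map ⁅_⁆ xs)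

module _ {n : ℕ} where

  open import Data.List.Membership.DecPropositional (_≟_ {n}) using (_∈?_)

  ∈-fromList⁺ : ∀ {x} {xs : List (Fin n)} → x ∈ˡ xs → x ∈ fromList xs
  ∈-fromList⁺ {xs = y ∷ _} (here refl) = x∈p∪q⁺ (inj₁ (x∈⁅x⁆ y))
  ∈-fromList⁺ {xs = _ ∷ _} (there x∈)  = x∈p∪q⁺ (inj₂ (∈-fromList⁺ x∈))

  ∈-fromList⁻ : ∀ {x} {xs : List (Fin n)} → x ∈ fromList xs → x ∈ˡ xs
  ∈-fromList⁻ {xs = []}     x∈ = contradiction x∈ ∉⊥
  ∈-fromList⁻ {xs = y ∷ ys} x∈ with x∈p∪q⁻ ⁅ y ⁆ (fromList ys) x∈
  ... | inj₁ x∈y  = here (x∈⁅y⁆⇒x≡y y x∈y)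
  ... | inj₂ x∈ys = there (∈-fromList⁻ x∈ys)

  ∣fromList∣≡length : ∀ {xs : List (Fin n)} → Unique xs → ∣ fromList xs ∣ ≡ length xs
  ∣fromList∣≡length {[]}     _            = ∣⊥∣≡0 n
  ∣fromList∣≡length {x ∷ xs} u@(_ ∷ xs!) = begin
    ∣ ⁅ x ⁆ ∪ fromList xs ∣      ≡⟨ ∣p∪q∣≡∣p∣+∣q∣ ⁅ x ⁆ (fromList xs) x#xs ⟩
    ∣ ⁅ x ⁆ ∣ + ∣ fromList xs ∣  ≡⟨ cong₂ _+_ (∣⁅x⁆∣≡1 x) (∣fromList∣≡length xs!) ⟩
    suc (length xs)              ∎
    where
    open ≡.≡-Reasoning
    x#xs : ∀ {y} → y ∈ ⁅ x ⁆ → y ∉ fromList xs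
    x#xs y∈x y∈xs = Unique[x∷xs]⇒x∉xs u (subst (_∈ˡ xs) (x∈⁅y⁆⇒x≡y x y∈x) (∈-fromList⁻ y∈xs))

  length<n⇒∃∉ : ∀ {xs : List (Fin n)} → Unique xs → length xs < n → ∃ λ y → y ∉ˡ xs
  length<n⇒∃∉ {xs} u |xs|<n = ¬∀⟶∃¬ n (_∈ˡ xs) (_∈? xs) λ covers → <⇒≱ |xs|<n (begin
    n                ≡⟨ ∣⊤∣≡n n ⟨
    ∣ ⊤ˢ {n} ∣       ≤⟨ p⊆q⇒∣p∣≤∣q∣ {p = ⊤ˢ} (λ {y} _ → ∈-fromList⁺ (covers y)) ⟩
    ∣ fromList xs ∣  ≡⟨ ∣fromList∣≡length u ⟩
    length xs        ∎)
    where open ≤-Reasoning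

  sum-∣fromList∣ : ∀ {B : Set} (f : B → List (Fin n)) xs → Unique (concatMap f xs) →
                   sum (tabulate (λ i → ∣ fromList (f (lookup xs i)) ∣)) ≡ length (concatMap f xs)
  sum-∣fromList∣ f []       _ = refl
  sum-∣fromList∣ f (x ∷ xs) u = begin
    ∣ fromList (f x) ∣ + sum (tabulate (λ i → ∣ fromList (f (lookup xs i)) ∣))
      ≡⟨ cong₂ _+_ (∣fromList∣≡length (Unique-++⁻ˡ (f x) u)) (sum-∣fromList∣ f xs (Unique-++⁻ʳ (f x) u)) ⟩
    length (f x) + length (concatMap f xs)
      ≡⟨ length-++ (f x) ⟨
    length (f x ++ concatMap f xs)
      ∎
    where open ≡.≡-Reasoning

Edge : ∀ {m} → Graph m → Fin m → Fin m → Set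
Edge G u w = Adj G u w ≡ true

module _ {m : ℕ} (G : Graph m) {S : Subset m} where

  walk-++ : ∀ {u v w} → WalkIn G S u v → WalkIn G S v w → WalkIn G S u w
  walk-++ (here _)      q = q
  walk-++ (step u∈ e p) q = step u∈ e (walk-++ p q)

  walk-∷ʳ : ∀ {u v w} → WalkIn G S u v → Edge G v w → w ∈ S → WalkIn G S u w
  walk-∷ʳ (here v∈)     e w∈ = step v∈ e (here w∈)
  walk-∷ʳ (step u∈ e p) f w∈ = step u∈ e (walk-∷ʳ p f w∈)

  walk-reverse : ∀ {u v} → WalkIn G S u v → WalkIn G S v u
  walk-reverse (here u∈)             = here u∈
  walk-reverse (step {u} {v} u∈ e p) = walk-∷ʳ (walk-reverse p) (≡.trans (Graph.sym G v u) e) u∈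

  open import Data.List.Membership.DecPropositional (_≟_ {m}) using (_∈?_)

  exit-edge : ∀ {a b} (xs : List (Fin m)) → WalkIn G S a b → a ∈ˡ xs → b ∉ˡ xs →
              ∃₂ λ u w → u ∈ˡ xs × w ∉ˡ xs × Edge G u w
  exit-edge xs (here _) a∈ b∉ = contradiction a∈ b∉
  exit-edge xs (step {v = v} _ e p) a∈ b∉ with v ∈? xs
  ... | yes v∈ = exit-edge xs p v∈ b∉
  ... | no  v∉ = -, -, a∈ , v∉ , e

module RootedTree {A : Set} (E : A → A → Set) where

  -- graft e s t hangs s below the root of t, so a node with subtrees s₁ … sₙ is
  -- graft e₁ s₁ (graft e₂ s₂ … (graft eₙ sₙ leaf)).
  data Tree (v : A) : Set where
    leaf  : Tree v
    graft : ∀ {w} → E v w → Tree w → Tree v → Tree v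

  vertices : ∀ {v} → Tree v → List A
  vertices {v} leaf      = v ∷ []
  vertices (graft _ s t) = vertices s ++ vertices t

  size : ∀ {v} → Tree v → ℕ
  size t = length (vertices t)

  verticesᶠ : List (∃ Tree) → List A
  verticesᶠ = concatMap (vertices ∘ proj₂)

  childRoots : ∀ {v} → Tree v → List A
  childRoots leaf              = []
  childRoots (graft {w} _ _ t) = w ∷ childRoots t

  root∈vertices : ∀ {v} (t : Tree v) → v ∈ˡ vertices t
  root∈vertices leaf          = here refl
  root∈vertices (graft _ s t) = ∈-++⁺ʳ (vertices s) (root∈vertices t)

  childRoots⊆vertices : ∀ {v x} (t : Tree v) → x ∈ˡ childRoots t → x ∈ˡ vertices t
  childRoots⊆vertices (graft _ s _) (here refl) = ∈-++⁺ˡ (root∈vertices s)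
  childRoots⊆vertices (graft _ s t) (there x∈)  = ∈-++⁺ʳ (vertices s) (childRoots⊆vertices t x∈)

  childRoots-edges : ∀ {v} (t : Tree v) → All (E v) (childRoots t)
  childRoots-edges leaf          = []
  childRoots-edges (graft e _ t) = e ∷ childRoots-edges t

  Unique-childRoots : ∀ {v} (t : Tree v) → Unique (vertices t) → Unique (childRoots t)
  Unique-childRoots leaf          _ = []
  Unique-childRoots (graft _ s t) u =
    ¬Any⇒All¬ (childRoots t)
      (λ w∈ → Unique-++⇒Disjoint (vertices s) u (root∈vertices s , childRoots⊆vertices t w∈))
    ∷ Unique-childRoots t (Unique-++⁻ʳ (vertices s) u)

  graft-leaf : ∀ {v u w} (t : Tree v) → u ∈ˡ vertices t → E u w →
               Σ (Tree v) λ t′ → vertices t′ ↭ w ∷ vertices t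
  graft-leaf leaf (here refl) e = graft e leaf leaf , ↭-refl
  graft-leaf (graft e′ s t) u∈ e with ∈-++⁻ (vertices s) u∈
  ... | inj₁ u∈s with graft-leaf s u∈s e
  ...   | s′ , s′↭ = graft e′ s′ t , ++⁺ʳ (vertices t) s′↭
  graft-leaf {w = w} (graft e′ s t) u∈ e | inj₂ u∈t with graft-leaf t u∈t e
  ...   | t′ , t′↭ = graft e′ s t′ , ↭-trans (++⁺ˡ (vertices s) t′↭) (shift w (vertices s) (vertices t))

  Branching : ℕ → ∀ {v} → Tree v → Set
  Branching k leaf             = ⊤
  Branching k t@(graft _ s t′) = length (childRoots t) ≤ k × Branching k s × Branching k t′

  Branching⇒children≤ : ∀ {k v} (t : Tree v) → Branching k t → length (childRoots t) ≤ k
  Branching⇒children≤ leaf          _       = z≤n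
  Branching⇒children≤ (graft _ _ _) (b , _) = b

  module Pruning (L k : ℕ) (L≥1 : 1 ≤ L) (k≥1 : 1 ≤ k) where

    SizeInRange : ∃ Tree → Set
    SizeInRange (_ , t) = L ≤ size t × size t ≤ L * k

    SmallBranches : ∀ {v} → Tree v → Set
    SmallBranches leaf          = ⊤
    SmallBranches (graft _ s t) = size s < L × SmallBranches t

    size+children≤ : ∀ {v} (t : Tree v) → SmallBranches t →
                     size t + length (childRoots t) ≤ suc (length (childRoots t) * L)
    size+children≤ leaf          _             = ≤-refl
    size+children≤ (graft _ s t) (s<L , small) = begin
      length (vertices s ++ vertices t) + suc c  ≡⟨ cong (_+ suc c) (length-++ (vertices s)) ⟩
      size s + size t + suc c                    ≡⟨ ≡.trans (+-suc _ c) (cong suc (+-assoc (size s) (size t) c)) ⟩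
      suc (size s) + (size t + c)                ≤⟨ +-mono-≤ s<L (size+children≤ t small) ⟩
      L + suc (c * L)                            ≡⟨ +-suc L (c * L) ⟩
      suc (L + c * L)                            ∎
      where
      c = length (childRoots t)
      open ≤-Reasoning

    size≤L*k : ∀ {v} (t : Tree v) → SmallBranches t → length (childRoots t) ≤ k → size t ≤ L * k
    size≤L*k t small c≤k = s+c≤1+c*L⇒s≤L*k L≥1 k≥1 c≤k (size+children≤ t small)

    record Pruned {v} (t : Tree v) : Set where
      field
        pieces        : List (∃ Tree)
        rest          : Tree v
        pieces-sized  : All SizeInRange pieces
        rest-small    : SmallBranches rest
        rest-children : length (childRoots rest) ≤ length (childRoots t)
        vertices-↭    : verticesᶠ pieces ++ vertices rest ↭ vertices t

    open Pruned

    rest-sized : ∀ {v} {t : Tree v} (P : Pruned t) → Branching k t → L ≤ size (rest P) →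
                 SizeInRange (-, rest P)
    rest-sized {t = t} P b large =
      large , size≤L*k (rest P) (rest-small P) (≤-trans (rest-children P) (Branching⇒children≤ t b))

    merge-↭ : ∀ {v w} {s : Tree w} {t : Tree v} (Ps : Pruned s) (Pt : Pruned t) →
              verticesᶠ (pieces Ps ++ pieces Pt) ++ (vertices (rest Ps) ++ vertices (rest Pt))
              ↭ vertices s ++ vertices t
    merge-↭ {s = s} {t} Ps Pt = begin
      verticesᶠ (pieces Ps ++ pieces Pt) ++ (rs ++ rt)
        ≡⟨ cong (_++ rs ++ rt) (concatMap-++ (vertices ∘ proj₂) (pieces Ps) (pieces Pt)) ⟩
      (ps ++ pt) ++ (rs ++ rt)  ↭⟨ ++-interchange ps pt rs rt ⟩
      (ps ++ rs) ++ (pt ++ rt)  ↭⟨ ++⁺ (vertices-↭ Ps) (vertices-↭ Pt) ⟩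
      vertices s ++ vertices t  ∎
      where
      open PermutationReasoning
      ps = verticesᶠ (pieces Ps)
      pt = verticesᶠ (pieces Pt)
      rs = vertices (rest Ps)
      rt = vertices (rest Pt)

    prune : ∀ {v} (t : Tree v) → Branching k t → Pruned t
    prune leaf _ = record
      { pieces = [] ; rest = leaf ; pieces-sized = [] ; rest-small = tt ; rest-children = z≤n
      ; vertices-↭ = ↭-refl }
    prune (graft e s t) (_ , bs , bt) with prune s bs | prune t bt
    ... | Ps | Pt with L ≤? size (rest Ps)
    ... | yes large = record
      { pieces        = (-, rest Ps) ∷ pieces Ps ++ pieces Pt
      ; rest          = rest Pt
      ; pieces-sized  = rest-sized Ps bs large ∷ All-++⁺ (pieces-sized Ps) (pieces-sized Pt)
      ; rest-small    = rest-small Pt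
      ; rest-children = m≤n⇒m≤1+n (rest-children Pt)
      ; vertices-↭    = ↭-trans (++-shifts (vertices (rest Ps)) _ _) (merge-↭ Ps Pt)
      }
    ... | no small = record
      { pieces        = pieces Ps ++ pieces Pt
      ; rest          = graft e (rest Ps) (rest Pt)
      ; pieces-sized  = All-++⁺ (pieces-sized Ps) (pieces-sized Pt)
      ; rest-small    = ≰⇒> small , rest-small Pt
      ; rest-children = s≤s (rest-children Pt)
      ; vertices-↭    = merge-↭ Ps Pt
      }

    record Partition {v} (t : Tree v) : Set where
      field
        parts          : List (∃ Tree)
        leftover       : List A
        parts-sized    : All SizeInRange parts
        leftover-small : length leftover < L
        parts-↭        : verticesᶠ parts ++ leftover ↭ vertices t

    open Partition

    partition : ∀ {v} (t : Tree v) → Branching k t → Partition t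
    partition t b with prune t b
    ... | P with L ≤? size (rest P)
    ... | yes large = record
      { parts          = (-, rest P) ∷ pieces P
      ; leftover       = []
      ; parts-sized    = rest-sized P b large ∷ pieces-sized P
      ; leftover-small = L≥1
      ; parts-↭        = ↭-trans (↭-reflexive (++-identityʳ _))
                           (↭-trans (++-comm (vertices (rest P)) _) (vertices-↭ P))
      }
    ... | no small = record
      { parts          = pieces P
      ; leftover       = vertices (rest P)
      ; parts-sized    = pieces-sized P
      ; leftover-small = ≰⇒> small
      ; parts-↭        = vertices-↭ P
      }

    size∸L≤covered : ∀ {v} {t : Tree v} (P : Partition t) → size t ∸ L ≤ length (verticesᶠ (parts P))
    size∸L≤covered {t = t} P = m≤n+o⇒m∸n≤o (size t) L (begin
      size t               ≡⟨ ↭-length (parts-↭ P) ⟨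
      length (covered ++ leftover P)   ≡⟨ length-++ covered ⟩
      length covered + length (leftover P) ≤⟨ +-monoʳ-≤ (length covered) (<⇒≤ (leftover-small P)) ⟩
      length covered + L   ≡⟨ +-comm (length covered) L ⟩
      L + length covered   ∎)
      where
      open ≤-Reasoning
      covered = verticesᶠ (parts P)

module _ {m : ℕ} (G : Graph m) where

  open RootedTree (Edge G)

  ∈-neighbourhood : ∀ {v w} → Edge G v w → w ∈ neighbourhood G v
  ∈-neighbourhood {v} {w} e = lookup⇒[]= w _ (≡.trans (lookup∘tabulate (Adj G v) w) e)

  Unique-neighbours≤degree : ∀ {v} {xs : List (Fin m)} → Unique xs → All (Edge G v) xs →
                             length xs ≤ degree G v
  Unique-neighbours≤degree {v} {xs} xs! adj = begin
    length xs        ≡⟨ ∣fromList∣≡length xs! ⟨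
    ∣ fromList xs ∣  ≤⟨ p⊆q⇒∣p∣≤∣q∣ (λ x∈ → ∈-neighbourhood (All.lookup adj (∈-fromList⁻ x∈))) ⟩
    degree G v       ∎
    where open ≤-Reasoning

  degree≤⇒Branching : ∀ {k} → (∀ v → degree G v ≤ k) →
                      ∀ {v} (t : Tree v) → Unique (vertices t) → Branching k t
  degree≤⇒Branching deg leaf             _ = tt
  degree≤⇒Branching deg t@(graft _ s t′) u =
    ≤-trans (Unique-neighbours≤degree (Unique-childRoots t u) (childRoots-edges t)) (deg _) ,
    degree≤⇒Branching deg s (Unique-++⁻ˡ (vertices s) u) ,
    degree≤⇒Branching deg t′ (Unique-++⁻ʳ (vertices s) u)

  walk-from-root : ∀ {S v x} (t : Tree v) → (∀ {y} → y ∈ˡ vertices t → y ∈ S) →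
                   x ∈ˡ vertices t → WalkIn G S v x
  walk-from-root leaf ⊆S (here refl) = here (⊆S (here refl))
  walk-from-root (graft e s t) ⊆S x∈ with ∈-++⁻ (vertices s) x∈
  ... | inj₁ x∈s = step (⊆S (∈-++⁺ʳ (vertices s) (root∈vertices t))) e
                        (walk-from-root s (⊆S ∘ ∈-++⁺ˡ) x∈s)
  ... | inj₂ x∈t = walk-from-root t (⊆S ∘ ∈-++⁺ʳ (vertices s)) x∈t

  tree-connected : ∀ {v} (t : Tree v) → InducedConnected G (fromList (vertices t))
  tree-connected t x y x∈ y∈ =
    walk-++ G (walk-reverse G (walk-from-root t ∈-fromList⁺ (∈-fromList⁻ x∈)))
              (walk-from-root t ∈-fromList⁺ (∈-fromList⁻ y∈))

  tree-of-size : Connected G → (r : Fin m) → ∀ n → n < m →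
                 Σ (Tree r) λ T → Unique (vertices T) × size T ≡ suc n
  tree-of-size conn r zero    _   = leaf , [] ∷ [] , refl
  tree-of-size conn r (suc n) n<m with tree-of-size conn r n (<-trans (n<1+n n) n<m)
  ... | T , T! , |T| with length<n⇒∃∉ T! (subst (_< m) (≡.sym |T|) n<m)
  ... | y , y∉ with exit-edge G (vertices T) (conn r y ∈⊤ ∈⊤) (root∈vertices T) y∉
  ... | _ , w , u∈ , w∉ , e with graft-leaf T u∈ e
  ... | T′ , T′↭ =
    T′ , Unique-resp-↭ (↭-sym T′↭) (¬Any⇒All¬ _ w∉ ∷ T!) , ≡.trans (↭-length T′↭) (cong suc |T|)

proposition2 : (m k : ℕ) → (G : Graph m) → Connected G → 1 ≤ m → 1 ≤ k
    → (∀ v → degree G v ≤ k)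
    → (l : ℕ) → 1 ≤ l
    → Σ ℕ λ t → Σ (Fin t → Subset m) λ V →
        (∀ i j → i ≢ j → ∀ x → x ∈ V i → x ∈ V j → ⊥)
        × (∀ i → (l * k ≤ ∣ V i ∣) × (∣ V i ∣ ≤ l * k ^ 2))
        × (m ∸ l * k ≤ sum (tabulate (λ i → ∣ V i ∣)))
        × (∀ i → InducedConnected G (V i))
proposition2 zero    _ _ _    () _   _   _ _
proposition2 (suc m) k G conn _  k≥1 deg l l≥1 with tree-of-size G conn zero m ≤-refl
... | T , T! , |T| = length parts , V , disjoint , sized , covering , connected
  where
  open RootedTree (Edge G)
  open Pruning (l * k) k (*-mono-≤ l≥1 k≥1) k≥1

  P : Partition T
  P = partition T (degree≤⇒Branching G deg T T!)

  open Partition P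

  V : Fin (length parts) → Subset (suc m)
  V i = fromList (vertices (proj₂ (lookup parts i)))

  parts! : Unique (verticesᶠ parts)
  parts! = Unique-++⁻ˡ (verticesᶠ parts) (Unique-resp-↭ (↭-sym parts-↭) T!)

  disjoint : ∀ i j → i ≢ j → ∀ x → x ∈ V i → x ∈ V j → ⊥
  disjoint i j i≢j x x∈i x∈j = Unique-concatMap⇒Disjoint-lookup (vertices ∘ proj₂) parts i≢j parts!
                                 (∈-fromList⁻ x∈i , ∈-fromList⁻ x∈j)

  sized : ∀ i → (l * k ≤ ∣ V i ∣) × (∣ V i ∣ ≤ l * k ^ 2)
  sized i with All.lookup parts-sized (∈-lookup i)
  ... | lower , upper = subst (λ n → l * k ≤ n × n ≤ l * k ^ 2) (≡.sym ∣V∣≡size)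
                          (lower , ≤-trans upper (≤-reflexive lk·k≡lk²))
    where
    ∣V∣≡size : ∣ V i ∣ ≡ size (proj₂ (lookup parts i))
    ∣V∣≡size = ∣fromList∣≡length (Unique-concatMap⇒Unique-lookup (vertices ∘ proj₂) parts i parts!)
    lk·k≡lk² : l * k * k ≡ l * k ^ 2
    lk·k≡lk² = ≡.trans (*-assoc l k k) (cong (λ n → l * (k * n)) (≡.sym (^-identityʳ k)))

  covering : suc m ∸ l * k ≤ sum (tabulate (λ i → ∣ V i ∣))
  covering = ≡.subst₂ (λ a b → a ∸ l * k ≤ b) |T|
               (≡.sym (sum-∣fromList∣ (vertices ∘ proj₂) parts parts!)) (size∸L≤covered P)

  connected : ∀ i → InducedConnected G (V i)
  connected i = tree-connected G (proj₂ (lookup parts i))
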